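{- Let $R$ be $\mathbb{Z}$ or $\mathbb{Z}[i]$ (viewed inside $\mathbb{C}=\mathbb{R}+\mathbb{R}i\subseteq\mathbb{H}$) and let $S=\{r+sj\mid r,s\in R\}\subseteq\mathbb{H}$ (so $S=\mathbb{Z}[j]$ if $R=\mathbb{Z}$, and $S=\{a+bi+cj+dk\mid a,b,c,d\in\mathbb{Z}\}$ if $R=\mathbb{Z}[i]$). Then $S$ has enough divisors: whenever $y,t\in S$ satisfy that $|y|^2$ divides $|t|^2$ in $\mathbb{Z}$, there exist $u,v\in S$ with $t=uv$ and $|u|^2=|y|^2$.
   Context: $\mathbb{H}$ denotes the Hamilton quaternions with basis $1,i,j,k$, and $|q|^2=q\overline{q}$ is the quaternion norm. -}

module Defs where

open import Data.Integer using (ℤ; _+_; _*_; _-_; 0ℤ)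
open import Relation.Binary.PropositionalEquality using (_≡_)
open import Data.Product using (_×_)
open import Data.Unit using (⊤)

record ℍℤ : Set where
  constructor quat
  field
    re ii jj kk : ℤ
open ℍℤ public

-- Hamilton product (i² = j² = k² = ijk = -1)
_·_ : ℍℤ → ℍℤ → ℍℤ
quat a₁ b₁ c₁ d₁ · quat a₂ b₂ c₂ d₂ = quat
  (a₁ * a₂ - b₁ * b₂ - c₁ * c₂ - d₁ * d₂)
  (a₁ * b₂ + b₁ * a₂ + c₁ * d₂ - d₁ * c₂)
  (a₁ * c₂ - b₁ * d₂ + c₁ * a₂ + d₁ * b₂)
  (a₁ * d₂ + b₁ * c₂ - c₁ * b₂ + d₁ * a₂)

normSq : ℍℤ → ℤ
normSq (quat a b c d) = a * a + b * b + c * c + d * d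

data BaseRing : Set where
  ℤ-ring  : BaseRing
  ℤi-ring : BaseRing

-- membership in R ⊆ ℂ = ℝ + ℝi ⊆ ℍ (as a subset of ℂ, written x + y i)
inR : BaseRing → ℤ → ℤ → Set
inR ℤ-ring  x y = y ≡ 0ℤ
inR ℤi-ring x y = ⊤

-- S = { r + s j | r, s ∈ R }.  With r = r₁ + r₂ i, s = s₁ + s₂ i one has
-- r + s j = r₁ + r₂ i + s₁ j + s₂ k  (since i j = k).
inS : BaseRing → ℍℤ → Set
inS R (quat a b c d) = inR R a b × inR R c d

{-# OPTIONS --safe #-}
-- Induction on ∥ y ∥.  Let p be a prime dividing ∥ y ∥.  If p divides both y and t, cancel it.
-- Otherwise S contains an element of norm p, and then every element of S whose norm is a
-- multiple of p has a left factor of norm p; split such factors off y and t and recurse.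
--
-- The key step, that t ∈ S with p ∣ ∥ t ∥ and p ∤ t has a left factor of norm p, is Lagrange's
-- descent.  Call d ∈ S with d · t ≡ 0 (mod p) and ∥ d ∥ = k p an annihilator of t; for k = 1,
-- t = conj d · (d · t / p).  If z is the balanced remainder of t modulo p, then conj z is an
-- annihilator with 0 < k < p, as conj z · z = ∥ z ∥ < p² and p ∤ t.  For 1 < k < p, an e ∈ S with
-- e · d ≡ 0 (mod m), ∥ e ∥ = r m and p ∤ m makes e · d / m an annihilator with k replaced by
-- k r / m < k: for odd k take m = k and e = conj z, z the balanced remainder of d modulo k; for
-- even k take m = 2 (p is odd here; p = 2 is settled by the same halving applied to t) and e one
-- of 1 - i, 1 - j, 1 - k.  Remainders keep zero coordinates zero, so everything stays in S.
module Submission where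

open import Defs
open import Data.Integer.Base using (ℤ; +_; -[1+_]; 0ℤ; 1ℤ; -1ℤ; _+_; _*_; _-_; -_; ∣_∣)
import Data.Integer.Properties as ℤ
import Data.Integer.Divisibility.Signed as ℤ
open import Data.Integer.Divisibility using (_∣_)
open import Data.Integer.DivMod using (_%ℕ_; _/ℕ_; n%ℕd<d; a≡a%ℕn+[a/ℕn]*n)
open import Data.Integer.Tactic.RingSolver using (solve)
open import Data.Nat.Base as ℕ using (ℕ; zero; suc; z≤n; s≤s; NonZero)
import Data.Nat.Properties as ℕ
import Data.Nat.Divisibility as ℕ
import Data.Nat.DivMod as ℕ
import Data.Nat.Tactic.RingSolver as ℕ
open import Data.Nat.Induction using (<-wellFounded)
open import Data.Nat.ListAction using (product)
open import Data.Nat.Primality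
  using (Prime; euclidsLemma; prime⇒irreducible; prime⇒nonZero; prime⇒nonTrivial; prime[2]; ¬prime[1])
open import Data.Nat.Primality.Factorisation using (factorise)
open import Data.List.Base using (List; _∷_; [])
import Data.List.Relation.Unary.All as All
open import Data.Product.Base using (Σ; ∃; _×_; _,_)
open import Data.Sum.Base using (_⊎_; inj₁; inj₂; [_,_]′; reduce)
open import Data.Unit.Base using (tt)
open import Function.Base using (_∘_; it)
open import Induction.WellFounded using (Acc; acc)
open import Relation.Nullary using (¬_; Dec; contradiction)
open import Relation.Nullary.Decidable using (yes; no; map′; _×-dec_)
open import Relation.Binary.PropositionalEquality
  using (_≡_; refl; sym; trans; cong; cong₂; subst; subst₂; module ≡-Reasoning)

conj : ℍℤ → ℍℤ
conj (quat a b c d) = quat a (- b) (- c) (- d)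

infixl 6 _⊕_
_⊕_ : ℍℤ → ℍℤ → ℍℤ
quat a b c d ⊕ quat e f g h = quat (a + e) (b + f) (c + g) (d + h)

infixr 7 _⊙_
_⊙_ : ℤ → ℍℤ → ℍℤ
n ⊙ quat a b c d = quat (n * a) (n * b) (n * c) (n * d)

scalar : ℤ → ℍℤ
scalar a = quat a 0ℤ 0ℤ 0ℤ

0ℍ 1ℍ : ℍℤ
0ℍ = scalar 0ℤ
1ℍ = scalar 1ℤ

mapCoords : (ℤ → ℤ) → ℍℤ → ℍℤ
mapCoords f (quat a b c d) = quat (f a) (f b) (f c) (f d)

quat-cong : ∀ {a b c d a′ b′ c′ d′} → a ≡ a′ → b ≡ b′ → c ≡ c′ → d ≡ d′ →
            quat a b c d ≡ quat a′ b′ c′ d′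
quat-cong refl refl refl refl = refl

-- The ring solver does not unfold _·_, so each identity below is stated coordinatewise.
·-assoc : ∀ x y z → (x · y) · z ≡ x · (y · z)
·-assoc (quat a b c d) (quat e f g h) (quat i j k l) = quat-cong re≡ ii≡ jj≡ kk≡
  where
  vars : List ℤ
  vars = a ∷ b ∷ c ∷ d ∷ e ∷ f ∷ g ∷ h ∷ i ∷ j ∷ k ∷ l ∷ []
  re≡ : (a * e - b * f - c * g - d * h) * i - (a * f + b * e + c * h - d * g) * j
          - (a * g - b * h + c * e + d * f) * k - (a * h + b * g - c * f + d * e) * l
      ≡ a * (e * i - f * j - g * k - h * l) - b * (e * j + f * i + g * l - h * k)
          - c * (e * k - f * l + g * i + h * j) - d * (e * l + f * k - g * j + h * i)
  re≡ = solve vars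
  ii≡ : (a * e - b * f - c * g - d * h) * j + (a * f + b * e + c * h - d * g) * i
          + (a * g - b * h + c * e + d * f) * l - (a * h + b * g - c * f + d * e) * k
      ≡ a * (e * j + f * i + g * l - h * k) + b * (e * i - f * j - g * k - h * l)
          + c * (e * l + f * k - g * j + h * i) - d * (e * k - f * l + g * i + h * j)
  ii≡ = solve vars
  jj≡ : (a * e - b * f - c * g - d * h) * k - (a * f + b * e + c * h - d * g) * l
          + (a * g - b * h + c * e + d * f) * i + (a * h + b * g - c * f + d * e) * j
      ≡ a * (e * k - f * l + g * i + h * j) - b * (e * l + f * k - g * j + h * i)
          + c * (e * i - f * j - g * k - h * l) + d * (e * j + f * i + g * l - h * k)
  jj≡ = solve vars
  kk≡ : (a * e - b * f - c * g - d * h) * l + (a * f + b * e + c * h - d * g) * k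
          - (a * g - b * h + c * e + d * f) * j + (a * h + b * g - c * f + d * e) * i
      ≡ a * (e * l + f * k - g * j + h * i) + b * (e * k - f * l + g * i + h * j)
          - c * (e * j + f * i + g * l - h * k) + d * (e * i - f * j - g * k - h * l)
  kk≡ = solve vars

·-distribˡ-⊕ : ∀ x y z → x · (y ⊕ z) ≡ x · y ⊕ x · z
·-distribˡ-⊕ (quat a b c d) (quat e f g h) (quat i j k l) = quat-cong re≡ ii≡ jj≡ kk≡
  where
  vars : List ℤ
  vars = a ∷ b ∷ c ∷ d ∷ e ∷ f ∷ g ∷ h ∷ i ∷ j ∷ k ∷ l ∷ []
  re≡ : a * (e + i) - b * (f + j) - c * (g + k) - d * (h + l)
      ≡ (a * e - b * f - c * g - d * h) + (a * i - b * j - c * k - d * l)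
  re≡ = solve vars
  ii≡ : a * (f + j) + b * (e + i) + c * (h + l) - d * (g + k)
      ≡ (a * f + b * e + c * h - d * g) + (a * j + b * i + c * l - d * k)
  ii≡ = solve vars
  jj≡ : a * (g + k) - b * (h + l) + c * (e + i) + d * (f + j)
      ≡ (a * g - b * h + c * e + d * f) + (a * k - b * l + c * i + d * j)
  jj≡ = solve vars
  kk≡ : a * (h + l) + b * (g + k) - c * (f + j) + d * (e + i)
      ≡ (a * h + b * g - c * f + d * e) + (a * l + b * k - c * j + d * i)
  kk≡ = solve vars

·-conjˡ : ∀ x → conj x · x ≡ scalar (normSq x)
·-conjˡ (quat a b c d) = quat-cong re≡ ii≡ jj≡ kk≡
  where
  vars : List ℤ
  vars = a ∷ b ∷ c ∷ d ∷ []
  re≡ : a * a - (- b) * b - (- c) * c - (- d) * d ≡ a * a + b * b + c * c + d * d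
  re≡ = solve vars
  ii≡ : a * b + (- b) * a + (- c) * d - (- d) * c ≡ 0ℤ
  ii≡ = solve vars
  jj≡ : a * c - (- b) * d + (- c) * a + (- d) * b ≡ 0ℤ
  jj≡ = solve vars
  kk≡ : a * d + (- b) * c - (- c) * b + (- d) * a ≡ 0ℤ
  kk≡ = solve vars

scalar-· : ∀ n x → scalar n · x ≡ n ⊙ x
scalar-· n (quat a b c d) = quat-cong re≡ ii≡ jj≡ kk≡
  where
  vars : List ℤ
  vars = n ∷ a ∷ b ∷ c ∷ d ∷ []
  re≡ : n * a - 0ℤ * b - 0ℤ * c - 0ℤ * d ≡ n * a
  re≡ = solve vars
  ii≡ : n * b + 0ℤ * a + 0ℤ * d - 0ℤ * c ≡ n * b
  ii≡ = solve vars
  jj≡ : n * c - 0ℤ * d + 0ℤ * a + 0ℤ * b ≡ n * c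
  jj≡ = solve vars
  kk≡ : n * d + 0ℤ * c - 0ℤ * b + 0ℤ * a ≡ n * d
  kk≡ = solve vars

·-scalar : ∀ n x → x · scalar n ≡ n ⊙ x
·-scalar n (quat a b c d) = quat-cong re≡ ii≡ jj≡ kk≡
  where
  vars : List ℤ
  vars = n ∷ a ∷ b ∷ c ∷ d ∷ []
  re≡ : a * n - b * 0ℤ - c * 0ℤ - d * 0ℤ ≡ n * a
  re≡ = solve vars
  ii≡ : a * 0ℤ + b * n + c * 0ℤ - d * 0ℤ ≡ n * b
  ii≡ = solve vars
  jj≡ : a * 0ℤ - b * 0ℤ + c * n + d * 0ℤ ≡ n * c
  jj≡ = solve vars
  kk≡ : a * 0ℤ + b * 0ℤ - c * 0ℤ + d * n ≡ n * d
  kk≡ = solve vars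

⊙-·ˡ : ∀ n x y → (n ⊙ x) · y ≡ n ⊙ (x · y)
⊙-·ˡ n x y = begin
  (n ⊙ x) · y         ≡⟨ cong (_· y) (sym (scalar-· n x)) ⟩
  (scalar n · x) · y  ≡⟨ ·-assoc (scalar n) x y ⟩
  scalar n · (x · y)  ≡⟨ scalar-· n (x · y) ⟩
  n ⊙ (x · y)         ∎
  where open ≡-Reasoning

⊙-·ʳ : ∀ n x y → x · (n ⊙ y) ≡ n ⊙ (x · y)
⊙-·ʳ n x y = begin
  x · (n ⊙ y)         ≡⟨ cong (x ·_) (sym (scalar-· n y)) ⟩
  x · (scalar n · y)  ≡⟨ sym (·-assoc x (scalar n) y) ⟩
  (x · scalar n) · y  ≡⟨ cong (_· y) (·-scalar n x) ⟩
  (n ⊙ x) · y         ≡⟨ ⊙-·ˡ n x y ⟩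
  n ⊙ (x · y)         ∎
  where open ≡-Reasoning

⊙-distribˡ-⊕ : ∀ n x y → n ⊙ x ⊕ n ⊙ y ≡ n ⊙ (x ⊕ y)
⊙-distribˡ-⊕ n (quat a b c d) (quat e f g h) = sym (quat-cong
  (ℤ.*-distribˡ-+ n a e) (ℤ.*-distribˡ-+ n b f) (ℤ.*-distribˡ-+ n c g) (ℤ.*-distribˡ-+ n d h))

1ℍ-· : ∀ x → 1ℍ · x ≡ x
1ℍ-· x@(quat a b c d) = trans (scalar-· 1ℤ x)
  (quat-cong (ℤ.*-identityˡ a) (ℤ.*-identityˡ b) (ℤ.*-identityˡ c) (ℤ.*-identityˡ d))

0ℍ-⊕ : ∀ x → 0ℍ ⊕ x ≡ x
0ℍ-⊕ (quat a b c d) =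
  quat-cong (ℤ.+-identityˡ a) (ℤ.+-identityˡ b) (ℤ.+-identityˡ c) (ℤ.+-identityˡ d)

scalar-* : ∀ a b → scalar (a * b) ≡ a ⊙ scalar b
scalar-* a b = let a*0≡0 = sym (ℤ.*-zeroʳ a) in quat-cong refl a*0≡0 a*0≡0 a*0≡0

normSq-· : ∀ x y → normSq (x · y) ≡ normSq x * normSq y
normSq-· (quat a b c d) (quat e f g h) = four-squares
  where
  vars : List ℤ
  vars = a ∷ b ∷ c ∷ d ∷ e ∷ f ∷ g ∷ h ∷ []
  four-squares :
      (a * e - b * f - c * g - d * h) * (a * e - b * f - c * g - d * h)
    + (a * f + b * e + c * h - d * g) * (a * f + b * e + c * h - d * g)
    + (a * g - b * h + c * e + d * f) * (a * g - b * h + c * e + d * f)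
    + (a * h + b * g - c * f + d * e) * (a * h + b * g - c * f + d * e)
    ≡ (a * a + b * b + c * c + d * d) * (e * e + f * f + g * g + h * h)
  four-squares = solve vars

normSq-⊕⊙ : ∀ x a y → ∃ λ e → normSq (x ⊕ a ⊙ y) ≡ normSq x + a * e
normSq-⊕⊙ (quat a b c d) n (quat e f g h) = _ , expand
  where
  vars : List ℤ
  vars = a ∷ b ∷ c ∷ d ∷ n ∷ e ∷ f ∷ g ∷ h ∷ []
  expand :
      (a + n * e) * (a + n * e) + (b + n * f) * (b + n * f)
    + (c + n * g) * (c + n * g) + (d + n * h) * (d + n * h)
    ≡ a * a + b * b + c * c + d * d
    + n * (+ 2 * (a * e + b * f + c * g + d * h) + n * (e * e + f * f + g * g + h * h))
  expand = solve vars

∥_∥ : ℍℤ → ℕ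
∥ quat a b c d ∥ = ∣ a ∣ ℕ.* ∣ a ∣ ℕ.+ ∣ b ∣ ℕ.* ∣ b ∣ ℕ.+ ∣ c ∣ ℕ.* ∣ c ∣ ℕ.+ ∣ d ∣ ℕ.* ∣ d ∣

normSq≡+∥∥ : ∀ x → normSq x ≡ + ∥ x ∥
normSq≡+∥∥ (quat a b c d) = begin
  a * a + b * b + c * c + d * d   ≡⟨ cong₂ _+_ (cong₂ _+_ (cong₂ _+_ (square a) (square b)) (square c)) (square d) ⟩
  + A + + B + + C + + D           ≡⟨ cong (λ i → i + + C + + D) (sym (ℤ.pos-+ A B)) ⟩
  + (A ℕ.+ B) + + C + + D         ≡⟨ cong (_+ + D) (sym (ℤ.pos-+ (A ℕ.+ B) C)) ⟩
  + (A ℕ.+ B ℕ.+ C) + + D         ≡⟨ sym (ℤ.pos-+ (A ℕ.+ B ℕ.+ C) D) ⟩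
  + (A ℕ.+ B ℕ.+ C ℕ.+ D)         ∎
  where
  open ≡-Reasoning
  square : ∀ a → a * a ≡ + (∣ a ∣ ℕ.* ∣ a ∣)
  square (+ n)    = sym (ℤ.pos-* n n)
  square -[1+ n ] = refl
  A B C D : ℕ
  A = ∣ a ∣ ℕ.* ∣ a ∣
  B = ∣ b ∣ ℕ.* ∣ b ∣
  C = ∣ c ∣ ℕ.* ∣ c ∣
  D = ∣ d ∣ ℕ.* ∣ d ∣

∣normSq∣ : ∀ x → ∣ normSq x ∣ ≡ ∥ x ∥
∣normSq∣ x = cong ∣_∣ (normSq≡+∥∥ x)

∥∥-· : ∀ x y → ∥ x · y ∥ ≡ ∥ x ∥ ℕ.* ∥ y ∥
∥∥-· x y = ℤ.+-injective (begin
  + ∥ x · y ∥             ≡⟨ sym (normSq≡+∥∥ (x · y)) ⟩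
  normSq (x · y)          ≡⟨ normSq-· x y ⟩
  normSq x * normSq y     ≡⟨ cong₂ _*_ (normSq≡+∥∥ x) (normSq≡+∥∥ y) ⟩
  + ∥ x ∥ * + ∥ y ∥       ≡⟨ sym (ℤ.pos-* ∥ x ∥ ∥ y ∥) ⟩
  + (∥ x ∥ ℕ.* ∥ y ∥)     ∎)
  where open ≡-Reasoning

∥∥-conj : ∀ x → ∥ conj x ∥ ≡ ∥ x ∥
∥∥-conj (quat a b c d) rewrite ℤ.∣-i∣≡∣i∣ b | ℤ.∣-i∣≡∣i∣ c | ℤ.∣-i∣≡∣i∣ d = refl

∥scalar∥ : ∀ n → ∥ scalar (+ n) ∥ ≡ n ℕ.* n
∥scalar∥ n = trans (ℕ.+-identityʳ _) (trans (ℕ.+-identityʳ _) (ℕ.+-identityʳ _))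

∥∥-⊙ : ∀ n x → ∥ + n ⊙ x ∥ ≡ n ℕ.* n ℕ.* ∥ x ∥
∥∥-⊙ n x = begin
  ∥ + n ⊙ x ∥                   ≡⟨ cong ∥_∥ (sym (scalar-· (+ n) x)) ⟩
  ∥ scalar (+ n) · x ∥          ≡⟨ ∥∥-· (scalar (+ n)) x ⟩
  ∥ scalar (+ n) ∥ ℕ.* ∥ x ∥    ≡⟨ cong (ℕ._* ∥ x ∥) (∥scalar∥ n) ⟩
  n ℕ.* n ℕ.* ∥ x ∥             ∎
  where open ≡-Reasoning

∥∥≡0⇒≡0ℍ : ∀ x → ∥ x ∥ ≡ 0 → x ≡ 0ℍ
∥∥≡0⇒≡0ℍ (quat a b c d) ∥x∥≡0 = quat-cong
  (square≡0 a (ℕ.m+n≡0⇒m≡0 A ab≡0)) (square≡0 b (ℕ.m+n≡0⇒n≡0 A ab≡0))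
  (square≡0 c (ℕ.m+n≡0⇒n≡0 (A ℕ.+ B) abc≡0)) (square≡0 d (ℕ.m+n≡0⇒n≡0 (A ℕ.+ B ℕ.+ C) ∥x∥≡0))
  where
  A B C : ℕ
  A = ∣ a ∣ ℕ.* ∣ a ∣
  B = ∣ b ∣ ℕ.* ∣ b ∣
  C = ∣ c ∣ ℕ.* ∣ c ∣
  abc≡0 : A ℕ.+ B ℕ.+ C ≡ 0
  abc≡0 = ℕ.m+n≡0⇒m≡0 (A ℕ.+ B ℕ.+ C) ∥x∥≡0
  ab≡0 : A ℕ.+ B ≡ 0
  ab≡0 = ℕ.m+n≡0⇒m≡0 (A ℕ.+ B) abc≡0
  square≡0 : ∀ a → ∣ a ∣ ℕ.* ∣ a ∣ ≡ 0 → a ≡ 0ℤ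
  square≡0 a = ℤ.∣i∣≡0⇒i≡0 ∘ reduce ∘ ℕ.m*n≡0⇒m≡0∨n≡0 ∣ a ∣

inS-scalar : ∀ R a → inS R (scalar a)
inS-scalar ℤ-ring  a = refl , refl
inS-scalar ℤi-ring a = tt , tt

inS-conj : ∀ R x → inS R x → inS R (conj x)
inS-conj ℤ-ring  (quat a .0ℤ c .0ℤ) (refl , refl) = refl , refl
inS-conj ℤi-ring _ _ = tt , tt

inS-· : ∀ R x y → inS R x → inS R y → inS R (x · y)
inS-· ℤ-ring (quat a .0ℤ c .0ℤ) (quat e .0ℤ g .0ℤ) (refl , refl) (refl , refl) = ii≡ , kk≡
  where
  vars : List ℤ
  vars = a ∷ c ∷ e ∷ g ∷ []
  ii≡ : a * 0ℤ + 0ℤ * e + c * 0ℤ - 0ℤ * g ≡ 0ℤ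
  ii≡ = solve vars
  kk≡ : a * 0ℤ + 0ℤ * g - c * 0ℤ + 0ℤ * e ≡ 0ℤ
  kk≡ = solve vars
inS-· ℤi-ring _ _ _ _ = tt , tt

inS-⊙⁻¹ : ∀ R n x .{{_ : NonZero n}} → inS R (+ n ⊙ x) → inS R x
inS-⊙⁻¹ ℤ-ring n (quat a b c d) (n*b≡0 , n*d≡0) = cancel n*b≡0 , cancel n*d≡0
  where
  cancel : ∀ {e} → + n * e ≡ 0ℤ → e ≡ 0ℤ
  cancel {e} eq = ℤ.*-cancelˡ-≡ (+ n) e 0ℤ (trans eq (sym (ℤ.*-zeroʳ (+ n))))
inS-⊙⁻¹ ℤi-ring _ _ _ = tt , tt

inS-mapCoords : ∀ R f → f 0ℤ ≡ 0ℤ → ∀ x → inS R x → inS R (mapCoords f x)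
inS-mapCoords ℤ-ring  f f0≡0 (quat a .0ℤ c .0ℤ) (refl , refl) = f0≡0 , f0≡0
inS-mapCoords ℤi-ring _ _ _ _ = tt , tt

infix 4 _∣ℍ_
_∣ℍ_ : ℕ → ℍℤ → Set
n ∣ℍ x = Σ ℍℤ λ s → x ≡ + n ⊙ s

∣ℍ-coords : ∀ {n a b c d} → (+ n ∣ a) × (+ n ∣ b) × (+ n ∣ c) × (+ n ∣ d) → n ∣ℍ quat a b c d
∣ℍ-coords {n} {a} {b} {c} {d} (n∣a , n∣b , n∣c , n∣d)
  with ℤ.∣ᵤ⇒∣ {+ n} {a} n∣a | ℤ.∣ᵤ⇒∣ {+ n} {b} n∣b | ℤ.∣ᵤ⇒∣ {+ n} {c} n∣c | ℤ.∣ᵤ⇒∣ {+ n} {d} n∣d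
... | ℤ.divides qa refl | ℤ.divides qb refl | ℤ.divides qc refl | ℤ.divides qd refl =
  quat qa qb qc qd , quat-cong (ℤ.*-comm qa _) (ℤ.*-comm qb _) (ℤ.*-comm qc _) (ℤ.*-comm qd _)

coords-∣ℍ : ∀ {n a b c d} → n ∣ℍ quat a b c d → (+ n ∣ a) × (+ n ∣ b) × (+ n ∣ c) × (+ n ∣ d)
coords-∣ℍ {n} (quat qa qb qc qd , refl) = ∣n* qa , ∣n* qb , ∣n* qc , ∣n* qd
  where
  ∣n* : ∀ q → + n ∣ + n * q
  ∣n* q = ℤ.∣⇒∣ᵤ (ℤ.divides q (ℤ.*-comm (+ n) q))

_∣ℍ?_ : ∀ n x → Dec (n ∣ℍ x)
n ∣ℍ? quat a b c d = map′ ∣ℍ-coords coords-∣ℍ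
  (n ℕ.∣? ∣ a ∣ ×-dec n ℕ.∣? ∣ b ∣ ×-dec n ℕ.∣? ∣ c ∣ ×-dec n ℕ.∣? ∣ d ∣)

⊙-cancel : ∀ {n} .{{_ : NonZero n}} {x y} → + n ⊙ x ≡ + n ⊙ y → x ≡ y
⊙-cancel {n} {x = quat a b c d} {quat e f g h} eq = quat-cong
  (ℤ.*-cancelˡ-≡ (+ n) a e (cong re eq)) (ℤ.*-cancelˡ-≡ (+ n) b f (cong ii eq))
  (ℤ.*-cancelˡ-≡ (+ n) c g (cong jj eq)) (ℤ.*-cancelˡ-≡ (+ n) d h (cong kk eq))

∣ℍ⇒∣∥∥ : ∀ {n x} → n ∣ℍ x → n ℕ.* n ℕ.∣ ∥ x ∥
∣ℍ⇒∣∥∥ {n} (s , refl) = ℕ.divides ∥ s ∥ (trans (∥∥-⊙ n s) (ℕ.*-comm (n ℕ.* n) ∥ s ∥))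

∣ℍ-cancel : ∀ {p m x y} → Prime p → ¬ p ℕ.∣ m → + m ⊙ x ≡ + p ⊙ y → p ∣ℍ x
∣ℍ-cancel {p} {m} {quat a b c d} {quat e f g h} pr p∤m eq = ∣ℍ-coords
  (coord (cong re eq) , coord (cong ii eq) , coord (cong jj eq) , coord (cong kk eq))
  where
  coord : ∀ {a e} → + m * a ≡ + p * e → + p ∣ a
  coord {a} {e} m*a≡p*e with euclidsLemma m ∣ a ∣ pr (ℕ.divides ∣ e ∣ (begin
    m ℕ.* ∣ a ∣    ≡⟨ sym (ℤ.abs-* (+ m) a) ⟩
    ∣ + m * a ∣    ≡⟨ cong ∣_∣ m*a≡p*e ⟩
    ∣ + p * e ∣    ≡⟨ ℤ.abs-* (+ p) e ⟩
    p ℕ.* ∣ e ∣    ≡⟨ ℕ.*-comm p ∣ e ∣ ⟩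
    ∣ e ∣ ℕ.* p    ∎))
    where open ≡-Reasoning
  ... | inj₁ p∣m = contradiction p∣m p∤m
  ... | inj₂ p∣a = p∣a

-- Reduction modulo n

infix 4 _≡_[mod_]
record _≡_[mod_] (x z : ℍℤ) (n : ℕ) : Set where
  constructor congruence
  field
    quotient : ℍℤ
    x≡z+n*quotient : x ≡ z ⊕ + n ⊙ quotient

divisionCoords : ∀ {n} rem quo → (∀ a → a ≡ rem a + + n * quo a) → ∀ x → x ≡ mapCoords rem x [mod n ]
divisionCoords rem quo division x@(quat a b c d) =
  congruence (mapCoords quo x) (quat-cong (division a) (division b) (division c) (division d))

∣∥∥-mod : ∀ {n x z} → x ≡ z [mod n ] → n ℕ.∣ ∥ x ∥ → n ℕ.∣ ∥ z ∥
∣∥∥-mod {n} {x} {z} (congruence y x≡) n∣∥x∥ with normSq-⊕⊙ z (+ n) y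
... | e , normSq-expand = subst (n ℕ.∣_) (∣normSq∣ z) (ℤ.∣⇒∣ᵤ n∣normSq-z)
  where
  n∣normSq-x : + n ℤ.∣ normSq x
  n∣normSq-x = ℤ.∣ᵤ⇒∣ (subst (n ℕ.∣_) (sym (∣normSq∣ x)) n∣∥x∥)
  n∣normSq-z : + n ℤ.∣ normSq z
  n∣normSq-z = ℤ.∣m+n∣n⇒∣m (subst (+ n ℤ.∣_) (trans (cong normSq x≡) normSq-expand) n∣normSq-x)
                           (ℤ.∣m⇒∣m*n e ℤ.∣-refl)

≡0ℍ-mod⇒∣ℍ : ∀ {n x z} → x ≡ z [mod n ] → ∥ z ∥ ≡ 0 → n ∣ℍ x
≡0ℍ-mod⇒∣ℍ {n} {x} {z} (congruence y x≡) ∥z∥≡0 =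
  y , trans x≡ (trans (cong (_⊕ + n ⊙ y) (∥∥≡0⇒≡0ℍ z ∥z∥≡0)) (0ℍ-⊕ (+ n ⊙ y)))

parity-division : ∀ a → a ≡ + (a %ℕ 2) + + 2 * (a /ℕ 2)
parity-division a = trans (a≡a%ℕn+[a/ℕn]*n a 2) (cong (_+_ (+ (a %ℕ 2))) (ℤ.*-comm (a /ℕ 2) (+ 2)))

balancedRem balancedQuo : ℕ → ℤ → ℤ
balancedRem h a = + ((a + + h) %ℕ (1 ℕ.+ 2 ℕ.* h)) - + h
balancedQuo h a = (a + + h) /ℕ (1 ℕ.+ 2 ℕ.* h)

balanced-division : ∀ h a → a ≡ balancedRem h a + + (1 ℕ.+ 2 ℕ.* h) * balancedQuo h a
balanced-division h a =
  shift a (+ h) (+ ((a + + h) %ℕ modulus)) ((a + + h) /ℕ modulus) (+ modulus)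
        (a≡a%ℕn+[a/ℕn]*n (a + + h) modulus)
  where
  modulus : ℕ
  modulus = 1 ℕ.+ 2 ℕ.* h
  shift : ∀ a h r q n → a + h ≡ r + q * n → a ≡ (r - h) + n * q
  shift a h r q n eq = begin
    a                  ≡⟨ solve (a ∷ h ∷ []) ⟩
    (a + h) - h        ≡⟨ cong (_- h) eq ⟩
    (r + q * n) - h    ≡⟨ solve (r ∷ q ∷ n ∷ h ∷ []) ⟩
    (r - h) + n * q    ∎
    where open ≡-Reasoning

balancedRem-0 : ∀ h → balancedRem h 0ℤ ≡ 0ℤ
balancedRem-0 h = trans (cong (λ r → + r - + h) (ℕ.m<n⇒m%n≡m (s≤s (ℕ.m≤n*m h 2))))
                        (ℤ.+-inverseʳ (+ h))

∣balancedRem∣≤ : ∀ h a → ∣ balancedRem h a ∣ ℕ.≤ h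
∣balancedRem∣≤ h a = ∣r-h∣≤h (ℕ.≤-pred (n%ℕd<d (a + + h) (1 ℕ.+ 2 ℕ.* h)))
  where
  ∣r-h∣≤h : ∀ {r} → r ℕ.≤ 2 ℕ.* h → ∣ + r - + h ∣ ℕ.≤ h
  ∣r-h∣≤h {r} r≤2h rewrite ℤ.m-n≡m⊖n r h with ℕ.≤-<-connex h r
  ... | inj₁ h≤r rewrite ℤ.⊖-≥ h≤r =
    ℕ.m≤n+o⇒m∸n≤o r h (subst (r ℕ.≤_) (cong (h ℕ.+_) (ℕ.+-identityʳ h)) r≤2h)
  ... | inj₂ r<h rewrite ℤ.∣⊖∣-< r<h = ℕ.m∸n≤m h r

∥balancedRem∥< : ∀ h x → ∥ mapCoords (balancedRem h) x ∥ ℕ.< (1 ℕ.+ 2 ℕ.* h) ℕ.* (1 ℕ.+ 2 ℕ.* h)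
∥balancedRem∥< h (quat a b c d) = ℕ.≤-<-trans
  (ℕ.+-mono-≤ (ℕ.+-mono-≤ (ℕ.+-mono-≤ (square≤ a) (square≤ b)) (square≤ c)) (square≤ d))
  (ℕ.≤-<-trans (ℕ.m≤m+n _ (4 ℕ.* h)) (ℕ.≤-reflexive (sym (odd-square h))))
  where
  square≤ : ∀ a → ∣ balancedRem h a ∣ ℕ.* ∣ balancedRem h a ∣ ℕ.≤ h ℕ.* h
  square≤ a = ℕ.*-mono-≤ (∣balancedRem∣≤ h a) (∣balancedRem∣≤ h a)
  odd-square : ∀ h → (1 ℕ.+ 2 ℕ.* h) ℕ.* (1 ℕ.+ 2 ℕ.* h)
                   ≡ 1 ℕ.+ (h ℕ.* h ℕ.+ h ℕ.* h ℕ.+ h ℕ.* h ℕ.+ h ℕ.* h ℕ.+ 4 ℕ.* h)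
  odd-square = ℕ.solve-∀

-- Annihilators modulo n

record Annihilator (R : BaseRing) (n : ℕ) (x : ℍℤ) (k : ℕ) : Set where
  constructor annihilator
  field
    element     : ℍℤ
    element∈S   : inS R element
    ∥element∥   : ∥ element ∥ ≡ k ℕ.* n
    annihilates : n ∣ℍ element · x

open Annihilator

annihilator-mod : ∀ {R n k x z} → x ≡ z [mod n ] → Annihilator R n z k → Annihilator R n x k
annihilator-mod {n = n} {x = x} {z} (congruence y x≡) (annihilator d d∈S ∥d∥≡ (s , d·z≡)) =
  annihilator d d∈S ∥d∥≡ (s ⊕ d · y , (begin
    d · x                      ≡⟨ cong (d ·_) x≡ ⟩
    d · (z ⊕ + n ⊙ y)          ≡⟨ ·-distribˡ-⊕ d z (+ n ⊙ y) ⟩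
    d · z ⊕ d · (+ n ⊙ y)      ≡⟨ cong₂ _⊕_ d·z≡ (⊙-·ʳ (+ n) d y) ⟩
    + n ⊙ s ⊕ + n ⊙ (d · y)    ≡⟨ ⊙-distribˡ-⊕ (+ n) s (d · y) ⟩
    + n ⊙ (s ⊕ d · y)          ∎))
  where open ≡-Reasoning

conj-annihilator : ∀ R {n k} z → inS R z → ∥ z ∥ ≡ k ℕ.* n → Annihilator R n z k
conj-annihilator R {n} {k} z z∈S ∥z∥≡ =
  annihilator (conj z) (inS-conj R z z∈S) (trans (∥∥-conj z) ∥z∥≡) (scalar (+ k) , (begin
    conj z · z                ≡⟨ ·-conjˡ z ⟩
    scalar (normSq z)         ≡⟨ cong scalar (trans (normSq≡+∥∥ z) (cong +_ (trans ∥z∥≡ (ℕ.*-comm k n)))) ⟩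
    scalar (+ (n ℕ.* k))      ≡⟨ cong scalar (ℤ.pos-* n k) ⟩
    scalar (+ n * + k)        ≡⟨ scalar-* (+ n) (+ k) ⟩
    + n ⊙ scalar (+ k)        ∎))
  where open ≡-Reasoning

data Bit : ℤ → Set where
  0b : Bit 0ℤ
  1b : Bit 1ℤ

bit : ∀ a → Bit (+ (a %ℕ 2))
bit a with a %ℕ 2 | n%ℕd<d a 2
... | 0           | _ = 0b
... | 1           | _ = 1b
... | suc (suc _) | s≤s (s≤s ())

2∤odd : ∀ h → ¬ 2 ℕ.∣ 1 ℕ.+ 2 ℕ.* h
2∤odd h (ℕ.divides q 1+2h≡q*2) = ℕ.even≢odd q h (trans (ℕ.*-comm 2 q) (sym 1+2h≡q*2))

-- Modulo 2, an element of even norm is annihilated by 1 - i, 1 - j or 1 - k; for R = ℤ it is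
-- 1 - j, which lies in S.
halvingTable : ∀ R {a b c d} → Bit a → Bit b → Bit c → Bit d → inS R (quat a b c d) →
               2 ℕ.∣ ∥ quat a b c d ∥ → Annihilator R 2 (quat a b c d) 1
halvingTable ℤ-ring  0b 0b 0b 0b _ _ = annihilator (quat 1ℤ 0ℤ -1ℤ 0ℤ) (refl , refl) refl (0ℍ , refl)
halvingTable ℤ-ring  1b 0b 1b 0b _ _ = annihilator (quat 1ℤ 0ℤ -1ℤ 0ℤ) (refl , refl) refl (1ℍ , refl)
halvingTable ℤ-ring  1b 0b 0b 0b _ 2∣1 = contradiction 2∣1 (2∤odd 0)
halvingTable ℤ-ring  0b 0b 1b 0b _ 2∣1 = contradiction 2∣1 (2∤odd 0)
halvingTable ℤ-ring  _  1b _  _  (() , _)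
halvingTable ℤ-ring  _  _  _  1b (_ , ())
halvingTable ℤi-ring 0b 0b 0b 0b _ _ = annihilator (quat 1ℤ 0ℤ -1ℤ 0ℤ) _ refl (0ℍ , refl)
halvingTable ℤi-ring 1b 1b 0b 0b _ _ = annihilator (quat 1ℤ -1ℤ 0ℤ 0ℤ) _ refl (1ℍ , refl)
halvingTable ℤi-ring 0b 0b 1b 1b _ _ = annihilator (quat 1ℤ -1ℤ 0ℤ 0ℤ) _ refl (quat 0ℤ 0ℤ 1ℤ 0ℤ , refl)
halvingTable ℤi-ring 1b 1b 1b 1b _ _ = annihilator (quat 1ℤ -1ℤ 0ℤ 0ℤ) _ refl (quat 1ℤ 0ℤ 1ℤ 0ℤ , refl)
halvingTable ℤi-ring 1b 0b 1b 0b _ _ = annihilator (quat 1ℤ 0ℤ -1ℤ 0ℤ) _ refl (1ℍ , refl)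
halvingTable ℤi-ring 0b 1b 0b 1b _ _ = annihilator (quat 1ℤ 0ℤ -1ℤ 0ℤ) _ refl (quat 0ℤ 0ℤ 0ℤ 1ℤ , refl)
halvingTable ℤi-ring 1b 0b 0b 1b _ _ = annihilator (quat 1ℤ 0ℤ 0ℤ -1ℤ) _ refl (1ℍ , refl)
halvingTable ℤi-ring 0b 1b 1b 0b _ _ = annihilator (quat 1ℤ 0ℤ 0ℤ -1ℤ) _ refl (quat 0ℤ 1ℤ 0ℤ 0ℤ , refl)
halvingTable ℤi-ring 1b 0b 0b 0b _ 2∣1 = contradiction 2∣1 (2∤odd 0)
halvingTable ℤi-ring 0b 1b 0b 0b _ 2∣1 = contradiction 2∣1 (2∤odd 0)
halvingTable ℤi-ring 0b 0b 1b 0b _ 2∣1 = contradiction 2∣1 (2∤odd 0)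
halvingTable ℤi-ring 0b 0b 0b 1b _ 2∣1 = contradiction 2∣1 (2∤odd 0)
halvingTable ℤi-ring 0b 1b 1b 1b _ 2∣3 = contradiction 2∣3 (2∤odd 1)
halvingTable ℤi-ring 1b 0b 1b 1b _ 2∣3 = contradiction 2∣3 (2∤odd 1)
halvingTable ℤi-ring 1b 1b 0b 1b _ 2∣3 = contradiction 2∣3 (2∤odd 1)
halvingTable ℤi-ring 1b 1b 1b 0b _ 2∣3 = contradiction 2∣3 (2∤odd 1)

halve : ∀ R {x} → inS R x → 2 ℕ.∣ ∥ x ∥ → Annihilator R 2 x 1
halve R {x@(quat a b c d)} x∈S 2∣∥x∥ = annihilator-mod x≡ (halvingTable R (bit a) (bit b) (bit c) (bit d)
  (inS-mapCoords R (λ a → + (a %ℕ 2)) refl x x∈S) (∣∥∥-mod x≡ 2∣∥x∥))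
  where
  x≡ : x ≡ mapCoords (λ a → + (a %ℕ 2)) x [mod 2 ]
  x≡ = divisionCoords (λ a → + (a %ℕ 2)) (_/ℕ 2) parity-division x

reduceOdd : ∀ R h {x} → inS R x → 1 ℕ.+ 2 ℕ.* h ℕ.∣ ∥ x ∥ → ¬ 1 ℕ.+ 2 ℕ.* h ∣ℍ x →
            ∃ λ r → 0 ℕ.< r × r ℕ.< 1 ℕ.+ 2 ℕ.* h × Annihilator R (1 ℕ.+ 2 ℕ.* h) x r
reduceOdd R h {x} x∈S n∣∥x∥ n∤x = fromRemainder (∣∥∥-mod x≡ n∣∥x∥)
  where
  modulus : ℕ
  modulus = 1 ℕ.+ 2 ℕ.* h
  remainder : ℍℤ
  remainder = mapCoords (balancedRem h) x
  x≡ : x ≡ remainder [mod modulus ]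
  x≡ = divisionCoords (balancedRem h) (balancedQuo h) (balanced-division h) x
  fromRemainder : modulus ℕ.∣ ∥ remainder ∥ →
                  ∃ λ r → 0 ℕ.< r × r ℕ.< modulus × Annihilator R modulus x r
  fromRemainder (ℕ.divides zero ∥z∥≡0) = contradiction (≡0ℍ-mod⇒∣ℍ x≡ ∥z∥≡0) n∤x
  fromRemainder (ℕ.divides r@(suc _) ∥z∥≡r*n) = r , s≤s z≤n ,
    ℕ.*-cancelʳ-< modulus r modulus (subst (ℕ._< modulus ℕ.* modulus) ∥z∥≡r*n (∥balancedRem∥< h x)) ,
    annihilator-mod x≡ (conj-annihilator R remainder (inS-mapCoords R (balancedRem h) (balancedRem-0 h) x x∈S) ∥z∥≡r*n)

-- Lagrange's descent

data EvenOrOdd : ℕ → Set where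
  even : ∀ h → EvenOrOdd (2 ℕ.* h)
  odd  : ∀ h → EvenOrOdd (1 ℕ.+ 2 ℕ.* h)

evenOrOdd : ∀ n → EvenOrOdd n
evenOrOdd zero = even 0
evenOrOdd (suc n) with evenOrOdd n
... | even h = odd h
... | odd h  = subst EvenOrOdd (ℕ.*-suc 2 h) (even (suc h))

∤⇒nonZero : ∀ {p m} → ¬ p ℕ.∣ m → NonZero m
∤⇒nonZero {p} {zero}  p∤0 = contradiction (p ℕ.∣0) p∤0
∤⇒nonZero {m = suc _} _   = _

shrink : ∀ {R p m c k r t} → Prime p → ¬ p ℕ.∣ m → (A : Annihilator R p t k) → k ≡ m ℕ.* c →
         Annihilator R m (element A) r → Annihilator R p t (c ℕ.* r)
shrink {R} {p} {m} {c} {k} {r} {t} pr p∤m (annihilator d d∈S ∥d∥≡ (s , d·t≡)) refl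
       (annihilator e e∈S ∥e∥≡ (w , e·d≡)) =
  annihilator w w∈S ∥w∥≡ (∣ℍ-cancel pr p∤m (begin
    + m ⊙ (w · t)       ≡⟨ sym (⊙-·ˡ (+ m) w t) ⟩
    (+ m ⊙ w) · t       ≡⟨ cong (_· t) (sym e·d≡) ⟩
    (e · d) · t         ≡⟨ ·-assoc e d t ⟩
    e · (d · t)         ≡⟨ cong (e ·_) d·t≡ ⟩
    e · (+ p ⊙ s)       ≡⟨ ⊙-·ʳ (+ p) e s ⟩
    + p ⊙ (e · s)       ∎))
  where
  open ≡-Reasoning
  instance
    m≢0 : NonZero m
    m≢0 = ∤⇒nonZero p∤m
    m*m≢0 : NonZero (m ℕ.* m)
    m*m≢0 = ℕ.m*n≢0 m m
  w∈S : inS R w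
  w∈S = inS-⊙⁻¹ R m w (subst (inS R) e·d≡ (inS-· R e d e∈S d∈S))
  ∥w∥≡ : ∥ w ∥ ≡ c ℕ.* r ℕ.* p
  ∥w∥≡ = ℕ.*-cancelˡ-≡ ∥ w ∥ (c ℕ.* r ℕ.* p) (m ℕ.* m) (begin
    m ℕ.* m ℕ.* ∥ w ∥              ≡⟨ sym (∥∥-⊙ m w) ⟩
    ∥ + m ⊙ w ∥                    ≡⟨ cong ∥_∥ (sym e·d≡) ⟩
    ∥ e · d ∥                      ≡⟨ ∥∥-· e d ⟩
    ∥ e ∥ ℕ.* ∥ d ∥                ≡⟨ cong₂ ℕ._*_ ∥e∥≡ ∥d∥≡ ⟩
    r ℕ.* m ℕ.* (m ℕ.* c ℕ.* p)    ≡⟨ regroup r m c p ⟩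
    m ℕ.* m ℕ.* (c ℕ.* r ℕ.* p)    ∎)
    where
    regroup : ∀ r m c p → r ℕ.* m ℕ.* (m ℕ.* c ℕ.* p) ≡ m ℕ.* m ℕ.* (c ℕ.* r ℕ.* p)
    regroup = ℕ.solve-∀

¬∣ℍ-of-norm : ∀ {p k x} → Prime p → 1 ℕ.< k → k ℕ.< p → ∥ x ∥ ≡ k ℕ.* p → ¬ k ∣ℍ x
¬∣ℍ-of-norm {p} {k} {x} pr 1<k k<p ∥x∥≡ k∣x =
  [ (λ k≡1 → ℕ.<-irrefl (sym k≡1) 1<k) , (λ k≡p → ℕ.<-irrefl k≡p k<p) ]′ (prime⇒irreducible pr k∣p)
  where
  instance
    k≢0 : NonZero k
    k≢0 = ℕ.>-nonZero (ℕ.<-trans (s≤s z≤n) 1<k)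
  k∣p : k ℕ.∣ p
  k∣p = ℕ.*-cancelˡ-∣ k (subst (k ℕ.* k ℕ.∣_) ∥x∥≡ (∣ℍ⇒∣∥∥ {k} {x} k∣x))

descend : ∀ {R p t k} → Prime p → ¬ p ℕ.∣ 2 → Acc ℕ._<_ k → 0 ℕ.< k → k ℕ.< p →
          Annihilator R p t k → Annihilator R p t 1
descend {R} {p} {t} {k} pr p∤2 (acc smaller) 0<k k<p A with evenOrOdd k
... | even (suc h) = descend pr p∤2 (smaller h<k) (s≤s z≤n) (ℕ.<-trans h<k k<p)
  (subst (Annihilator R p t) (ℕ.*-identityʳ (suc h))
    (shrink pr p∤2 A refl (halve R (element∈S A) 2∣∥d∥)))
  where
  h<k : suc h ℕ.< 2 ℕ.* suc h
  h<k = ℕ.m<m+n (suc h) (s≤s z≤n)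
  2∣∥d∥ : 2 ℕ.∣ ∥ element A ∥
  2∣∥d∥ = subst (2 ℕ.∣_) (sym (∥element∥ A)) (ℕ.∣m⇒∣m*n p (ℕ.m∣m*n (suc h)))
... | odd zero = A
... | odd h@(suc _) = continue (reduceOdd R h (element∈S A) k∣∥d∥ k∤d)
  where
  k∣∥d∥ : k ℕ.∣ ∥ element A ∥
  k∣∥d∥ = subst (k ℕ.∣_) (sym (∥element∥ A)) (ℕ.m∣m*n p)
  k∤d : ¬ k ∣ℍ element A
  k∤d = ¬∣ℍ-of-norm pr (s≤s (s≤s z≤n)) k<p (∥element∥ A)
  p∤k : ¬ p ℕ.∣ k
  p∤k = ℕ.<⇒≱ k<p ∘ ℕ.∣⇒≤
  continue : ∃ (λ r → 0 ℕ.< r × r ℕ.< k × Annihilator R k (element A) r) → Annihilator R p t 1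
  continue (r , 0<r , r<k , B) = descend pr p∤2 (smaller r<k) 0<r (ℕ.<-trans r<k k<p)
    (subst (Annihilator R p t) (ℕ.*-identityˡ r)
      (shrink {c = 1} pr p∤k A (sym (ℕ.*-identityʳ k)) B))

prime⇒2∨odd : ∀ {p} → Prime p → p ≡ 2 ⊎ ∃ λ h → p ≡ 1 ℕ.+ 2 ℕ.* h
prime⇒2∨odd {p} pr with evenOrOdd p
... | odd h  = inj₂ (h , refl)
... | even h = [ (λ ()) , inj₁ ∘ sym ]′ (prime⇒irreducible pr (ℕ.m∣m*n h))

oddPrime∤2 : ∀ h → Prime (1 ℕ.+ 2 ℕ.* h) → ¬ 1 ℕ.+ 2 ℕ.* h ℕ.∣ 2
oddPrime∤2 h pr p∣2 with prime⇒irreducible prime[2] p∣2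
... | inj₁ p≡1 = ¬prime[1] (subst Prime p≡1 pr)
... | inj₂ p≡2 = ℕ.even≢odd 1 h (sym p≡2)

primeAnnihilator : ∀ R {p t} → Prime p → inS R t → p ℕ.∣ ∥ t ∥ → ¬ p ∣ℍ t → Annihilator R p t 1
primeAnnihilator R {p} {t} pr t∈S p∣∥t∥ p∤t with prime⇒2∨odd pr
... | inj₁ refl     = halve R t∈S p∣∥t∥
... | inj₂ (h , refl) = continue (reduceOdd R h t∈S p∣∥t∥ p∤t)
  where
  continue : ∃ (λ r → 0 ℕ.< r × r ℕ.< p × Annihilator R p t r) → Annihilator R p t 1
  continue (r , 0<r , r<p , A) = descend pr (oddPrime∤2 h pr) (<-wellFounded r) 0<r r<p A

record Factorisation (R : BaseRing) (m : ℕ) (t : ℍℤ) : Set where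
  constructor factorisation
  field
    left right : ℍℤ
    left∈S     : inS R left
    right∈S    : inS R right
    t≡left·right : t ≡ left · right
    ∥left∥     : ∥ left ∥ ≡ m

annihilator⇒factorisation : ∀ R {n t} .{{_ : NonZero n}} → inS R t → Annihilator R n t 1 → Factorisation R n t
annihilator⇒factorisation R {n} {t} t∈S (annihilator d d∈S ∥d∥≡ (v , d·t≡)) =
  factorisation (conj d) v (inS-conj R d d∈S) v∈S (⊙-cancel (begin
    + n ⊙ t                ≡⟨ sym (scalar-· (+ n) t) ⟩
    scalar (+ n) · t       ≡⟨ cong (λ a → scalar a · t) (sym normSq-d) ⟩
    scalar (normSq d) · t  ≡⟨ cong (_· t) (sym (·-conjˡ d)) ⟩
    (conj d · d) · t       ≡⟨ ·-assoc (conj d) d t ⟩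
    conj d · (d · t)       ≡⟨ cong (conj d ·_) d·t≡ ⟩
    conj d · (+ n ⊙ v)     ≡⟨ ⊙-·ʳ (+ n) (conj d) v ⟩
    + n ⊙ (conj d · v)     ∎))
    (trans (∥∥-conj d) ∥d∥≡n)
  where
  open ≡-Reasoning
  ∥d∥≡n : ∥ d ∥ ≡ n
  ∥d∥≡n = trans ∥d∥≡ (ℕ.*-identityˡ n)
  normSq-d : normSq d ≡ + n
  normSq-d = trans (normSq≡+∥∥ d) (cong +_ ∥d∥≡n)
  v∈S : inS R v
  v∈S = inS-⊙⁻¹ R n v (subst (inS R) d·t≡ (inS-· R d t d∈S t∈S))

primeFactorisation : ∀ R {p t} → Prime p → inS R t → p ℕ.∣ ∥ t ∥ → ¬ p ∣ℍ t → Factorisation R p t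
primeFactorisation R pr t∈S p∣∥t∥ p∤t =
  annihilator⇒factorisation R {{prime⇒nonZero pr}} t∈S (primeAnnihilator R pr t∈S p∣∥t∥ p∤t)

factorOfPrimeNorm : ∀ R {p} w {t} → Prime p → inS R w → ∥ w ∥ ≡ p → inS R t → p ℕ.∣ ∥ t ∥ →
                    Factorisation R p t
factorOfPrimeNorm R {p} w {t} pr w∈S ∥w∥≡p t∈S p∣∥t∥ with p ∣ℍ? t
... | no p∤t = primeFactorisation R pr t∈S p∣∥t∥ p∤t
... | yes (t₀ , t≡) = annihilator⇒factorisation R {{prime⇒nonZero pr}} t∈S
  (annihilator (conj w) (inS-conj R w w∈S) (trans (∥∥-conj w) (trans ∥w∥≡p (sym (ℕ.*-identityˡ p))))
    (conj w · t₀ , trans (cong (conj w ·_) t≡) (⊙-·ʳ (+ p) (conj w) t₀)))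

scalarFactorisation : ∀ R {n x} .{{_ : NonZero n}} → inS R x → n ∣ℍ x → Factorisation R (n ℕ.* n) x
scalarFactorisation R {n} x∈S (x₀ , x≡) = factorisation (scalar (+ n)) x₀ (inS-scalar R (+ n))
  (inS-⊙⁻¹ R n x₀ (subst (inS R) x≡ x∈S)) (trans x≡ (sym (scalar-· (+ n) x₀))) (∥scalar∥ n)

refine : ∀ {R a b t} (F : Factorisation R a t) → Factorisation R b (Factorisation.right F) →
         Factorisation R (a ℕ.* b) t
refine {R} (factorisation u₁ t₁ u₁∈S _ t≡u₁·t₁ ∥u₁∥) (factorisation u₂ v u₂∈S v∈S t₁≡u₂·v ∥u₂∥) =
  factorisation (u₁ · u₂) v (inS-· R u₁ u₂ u₁∈S u₂∈S) v∈S
    (trans t≡u₁·t₁ (trans (cong (u₁ ·_) t₁≡u₂·v) (sym (·-assoc u₁ u₂ v))))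
    (trans (∥∥-· u₁ u₂) (cong₂ ℕ._*_ ∥u₁∥ ∥u₂∥))

EnoughDivisors : BaseRing → ℕ → Set
EnoughDivisors R m = ∀ y t → inS R y → inS R t → ∥ y ∥ ≡ m → m ℕ.∣ ∥ t ∥ → Factorisation R m t

commonFactor : ∀ R {p} y t → Prime p → inS R y → inS R t → p ℕ.∣ ∥ y ∥ → ∥ y ∥ ℕ.∣ ∥ t ∥ →
               ∃ λ d → 1 ℕ.< d × Factorisation R d y × Factorisation R d t
commonFactor R {p} y t pr y∈S t∈S p∣∥y∥ ∥y∥∣∥t∥ = byCases (p ∣ℍ? y) (p ∣ℍ? t)
  where
  instance
    p≢0 : NonZero p
    p≢0 = prime⇒nonZero pr
  1<p : 1 ℕ.< p
  1<p = ℕ.nonTrivial⇒n>1 p {{prime⇒nonTrivial pr}}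
  p∣∥t∥ : p ℕ.∣ ∥ t ∥
  p∣∥t∥ = ℕ.∣-trans p∣∥y∥ ∥y∥∣∥t∥
  viaPrimeNorm : ∀ {z} → Factorisation R p z → ∃ λ d → 1 ℕ.< d × Factorisation R d y × Factorisation R d t
  viaPrimeNorm (factorisation w _ w∈S _ _ ∥w∥≡p) =
    p , 1<p , factorOfPrimeNorm R w pr w∈S ∥w∥≡p y∈S p∣∥y∥ , factorOfPrimeNorm R w pr w∈S ∥w∥≡p t∈S p∣∥t∥
  byCases : Dec (p ∣ℍ y) → Dec (p ∣ℍ t) → ∃ λ d → 1 ℕ.< d × Factorisation R d y × Factorisation R d t
  byCases (yes p∣y) (yes p∣t) =
    p ℕ.* p , ℕ.<-≤-trans 1<p (ℕ.m≤m*n p p) , scalarFactorisation R y∈S p∣y , scalarFactorisation R t∈S p∣t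
  byCases (no p∤y) _        = viaPrimeNorm (primeFactorisation R pr y∈S p∣∥y∥ p∤y)
  byCases (yes _)  (no p∤t) = viaPrimeNorm (primeFactorisation R pr t∈S p∣∥t∥ p∤t)

primeDivisor : ∀ n → ∃ λ p → Prime p × p ℕ.∣ suc (suc n)
primeDivisor n with factorise (suc (suc n))
... | record { factors = p ∷ ps ; isFactorisation = n≡ ; factorsPrime = pr All.∷ _ } =
  p , pr , ℕ.divides (product ps) (trans n≡ (ℕ.*-comm p (product ps)))

cancelCommonFactor : ∀ {R m d y t} {{_ : NonZero m}} → (∀ {m′} → m′ ℕ.< m → EnoughDivisors R m′) →
                     1 ℕ.< d → Factorisation R d y → Factorisation R d t →
                     ∥ y ∥ ≡ m → m ℕ.∣ ∥ t ∥ → Factorisation R m t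
cancelCommonFactor {R} {m} {d} {y} {t} smaller 1<d (factorisation a y′ _ y′∈S y≡a·y′ ∥a∥≡d)
                   Ft@(factorisation b t′ _ t′∈S t≡b·t′ ∥b∥≡d) ∥y∥≡m m∣∥t∥ =
  subst (λ n → Factorisation R n t) (sym m≡d*∥y′∥)
    (refine Ft (smaller ∥y′∥<m y′ t′ y′∈S t′∈S refl (ℕ.*-cancelˡ-∣ d (subst₂ ℕ._∣_ m≡d*∥y′∥ ∥t∥≡d*∥t′∥ m∣∥t∥))))
  where
  m≡d*∥y′∥ : m ≡ d ℕ.* ∥ y′ ∥
  m≡d*∥y′∥ = trans (sym ∥y∥≡m) (trans (cong ∥_∥ y≡a·y′) (trans (∥∥-· a y′) (cong (ℕ._* ∥ y′ ∥) ∥a∥≡d)))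
  instance
    d≢0 : NonZero d
    d≢0 = ℕ.>-nonZero (ℕ.<-trans (s≤s z≤n) 1<d)
    ∥y′∥≢0 : NonZero ∥ y′ ∥
    ∥y′∥≢0 = ℕ.m*n≢0⇒n≢0 d {{subst NonZero m≡d*∥y′∥ it}}
  ∥t∥≡d*∥t′∥ : ∥ t ∥ ≡ d ℕ.* ∥ t′ ∥
  ∥t∥≡d*∥t′∥ = trans (cong ∥_∥ t≡b·t′) (trans (∥∥-· b t′) (cong (ℕ._* ∥ t′ ∥) ∥b∥≡d))
  ∥y′∥<m : ∥ y′ ∥ ℕ.< m
  ∥y′∥<m = subst (∥ y′ ∥ ℕ.<_) (trans (ℕ.*-comm ∥ y′ ∥ d) (sym m≡d*∥y′∥))
             (ℕ.m<m*n ∥ y′ ∥ d 1<d)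

enoughDivisors : ∀ R m → Acc ℕ._<_ m → EnoughDivisors R m
enoughDivisors R zero _ _ t _ t∈S _ 0∣∥t∥ =
  factorisation 0ℍ 0ℍ (inS-scalar R 0ℤ) (inS-scalar R 0ℤ) (∥∥≡0⇒≡0ℍ t (ℕ.0∣⇒≡0 0∣∥t∥)) refl
enoughDivisors R 1 _ _ t _ t∈S _ _ = factorisation 1ℍ t (inS-scalar R 1ℤ) t∈S (sym (1ℍ-· t)) refl
enoughDivisors R m@(suc (suc n)) (acc smaller) y t y∈S t∈S ∥y∥≡m m∣∥t∥ =
  let p , pr , p∣m = primeDivisor n
      d , 1<d , Fy , Ft = commonFactor R y t pr y∈S t∈S (subst (p ℕ.∣_) (sym ∥y∥≡m) p∣m)
                                       (subst (ℕ._∣ ∥ t ∥) (sym ∥y∥≡m) m∣∥t∥)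
  in cancelCommonFactor (λ m′<m → enoughDivisors R _ (smaller m′<m)) 1<d Fy Ft ∥y∥≡m m∣∥t∥

mainTheorem19 : (R : BaseRing) → (y t : ℍℤ) → inS R y → inS R t →
    normSq y ∣ normSq t →
    Σ ℍℤ (λ u → Σ ℍℤ (λ v → inS R u × inS R v × (t ≡ u · v) × (normSq u ≡ normSq y)))
mainTheorem19 R y t y∈S t∈S normSq-y∣normSq-t =
  left , right , left∈S , right∈S , t≡left·right ,
  trans (normSq≡+∥∥ left) (trans (cong +_ ∥left∥) (sym (normSq≡+∥∥ y)))
  where
  open Factorisation (enoughDivisors R ∥ y ∥ (<-wellFounded ∥ y ∥) y t y∈S t∈S refl
                        (subst₂ ℕ._∣_ (∣normSq∣ y) (∣normSq∣ t) normSq-y∣normSq-t))
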